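{- Let $\partial:\mathbf{WSym}\to\mathbf{WSym}$ be the linear map with $\partial(1)=0$ and, for a set partition $\pi=\{\pi_1,\dots,\pi_k\}$ of $\{1,\dots,n\}$ with $n\ge1$, $$\partial(\Phi_\pi)=\sum_{i=1}^k\Phi_{(\pi\setminus\{\pi_i\})\cup\{\pi_i\cup\{n+1\}\}}.$$ Let $\phi:\mathbf{WSym}\to\mathbf{WSym}$ be the linear map with $\phi(M_\pi)=\Phi_\pi$ for every set partition $\pi$, and let $\mu$ be right multiplication by $\Phi_{\{\{1\}\}}$, $\mu(x)=x\,\Phi_{\{\{1\}\}}$. Then for every $x\in\mathbf{WSym}$, $$\partial(x)=\phi\big(\mu(\phi^{ -1}(x))\big)-\mu(x),$$ i.e. (with operators written on the right and composed from left to right, as in the paper) $\partial=\phi^{ -1}\circ\mu\circ\phi-\mu$.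
   Context: $\mathbf{WSym}$ is the algebra with basis $(\Phi_\pi)$ indexed by set partitions $\pi$ of $\{1,\dots,n\}$, $n\ge0$ ($\Phi_\emptyset=1$), with product $\Phi_\pi\Phi_{\pi'}=\Phi_{\pi\cup\pi'[n]}$ when $\pi$ is a partition of $\{1,\dots,n\}$, where $\pi'[n]$ adds $n$ to each element of each block of $\pi'$. For set partitions $\pi,\pi'$ of the same set, $\pi\le\pi'$ means $\pi$ is finer than $\pi'$ (each block of $\pi'$ is a union of blocks of $\pi$). The word monomial basis $(M_\pi)$ is defined by $\Phi_\pi=\sum_{\pi\le\pi'}M_{\pi'}$. -}

module Defs where

open import Level using (Level; _⊔_)
open import Algebra.Bundles using (CommutativeRing)
open import Data.Nat using (ℕ; zero; suc; _≤_) renaming (_+_ to _+ℕ_)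
open import Data.Nat.Properties using (+-comm)
open import Data.Fin as Fin using (Fin; fromℕ; inject₁; _↑ʳ_; cast)
open import Data.Fin.Properties using (all?) renaming (_≟_ to _≟F_)
open import Data.Vec using (Vec; []; _∷ʳ_; lookup) renaming (map to vmap)
open import Data.List using (List; []; _∷_; [_]; _++_; map; concatMap; foldr; allFin)
open import Data.Product using (Σ; _,_; _×_)
open import Relation.Nullary using (Dec; yes; no)
open import Relation.Nullary.Decidable using (_→-dec_)
open import Relation.Binary.PropositionalEquality using (_≡_; refl)
open import Data.Bool using (if_then_else_)
open import Relation.Nullary using (does)

-- Set partitions of {1,…,n}, encoded canonically as restricted growth
-- strings.  A value of  RGS n k  is a set partition of {1,…,n} into k
-- blocks, built by adding the elements 1,2,…,n in order: element n+1
-- either joins an existing block (numbered by Fin k, blocks numbered in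
-- order of their minimal element) or starts a new singleton block.

data RGS : ℕ → ℕ → Set where
  []    : RGS 0 0
  _▷_   : ∀ {n k} → RGS n k → Fin k → RGS (suc n) k
  _▷new : ∀ {n k} → RGS n k → RGS (suc n) (suc k)

SetPartition : ℕ → Set
SetPartition n = Σ ℕ (RGS n)

-- labels π : the block index of each element (element a+1 is position a)
labels : ∀ {n k} → RGS n k → Vec (Fin k) n
labels []        = []
labels (π ▷ i)   = labels π ∷ʳ i
labels {k = suc k} (π ▷new) = vmap inject₁ (labels π) ∷ʳ fromℕ k

blockOf : ∀ {n k} → RGS n k → Fin n → Fin k
blockOf π a = lookup (labels π) a

_≤P_ : ∀ {n} → SetPartition n → SetPartition n → Set
(k , π) ≤P (k' , π') = ∀ a b → blockOf π a ≡ blockOf π b → blockOf π' a ≡ blockOf π' b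

_≤P?_ : ∀ {n} (p q : SetPartition n) → Dec (p ≤P q)
(k , π) ≤P? (k' , π') =
  all? (λ a → all? (λ b → (blockOf π a ≟F blockOf π b) →-dec (blockOf π' a ≟F blockOf π' b)))

_≟SP_ : ∀ {n} (p q : SetPartition n) → Dec (p ≡ q)
(_ , []) ≟SP (_ , []) = yes refl
(k , π ▷ i) ≟SP (k' , σ ▷ j) with (k , π) ≟SP (k' , σ)
... | no ne = no λ { refl → ne refl }
... | yes refl with i ≟F j
...   | yes refl = yes refl
...   | no ne = no λ { refl → ne refl }
(_ , π ▷ i) ≟SP (_ , σ ▷new) = no λ ()
(_ , π ▷new) ≟SP (_ , σ ▷ j) = no λ ()
(suc k , π ▷new) ≟SP (suc k' , σ ▷new) with (k , π) ≟SP (k' , σ)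
... | yes refl = yes refl
... | no ne = no λ { refl → ne refl }

partitions : (n : ℕ) → List (SetPartition n)
partitions zero    = [ (0 , []) ]
partitions (suc n) = concatMap ext (partitions n)
  where
  ext : SetPartition n → List (SetPartition (suc n))
  ext (k , π) = map (λ i → (k , π ▷ i)) (allFin k) ++ [ (suc k , π ▷new) ]

-- shifted concatenation: π ∪ π'[n]  (π of {1..n}, π' of {1..m});
-- the blocks of π' are shifted by n and become new blocks after those of π.
concatRGS : ∀ {n k m j} → RGS n k → RGS m j → RGS (m +ℕ n) (j +ℕ k)
concatRGS π []        = π
concatRGS {k = k} {j = j} π (σ ▷ i) = concatRGS π σ ▷ cast (+-comm k _) (k ↑ʳ i)
concatRGS π (σ ▷new)  = concatRGS π σ ▷new

-- product of basis set partitions: Φ_π Φ_π' = Φ_{π ∪ π'[n]}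
_·SP_ : ∀ {n m} → SetPartition n → SetPartition m → SetPartition (m +ℕ n)
(k , π) ·SP (j , σ) = (j +ℕ k , concatRGS π σ)

single : SetPartition 1
single = (1 , [] ▷new)

-- WSym over a commutative ring R.  An element is given by its
-- coordinates in the Φ basis, graded by n: x = Σ_n Σ_π (x n π) Φ_π,
-- with finite support (FinSupp).

module WSymOver {c ℓ : Level} (R : CommutativeRing c ℓ) where
  open CommutativeRing R

  Hom : ℕ → Set c
  Hom n = SetPartition n → Carrier

  Coef : Set c
  Coef = (n : ℕ) → Hom n

  FinSupp : Coef → Set ℓ
  FinSupp x = Σ ℕ λ N → ∀ n → N ≤ n → ∀ σ → x n σ ≈ 0#

  _≈W_ : Coef → Coef → Set ℓ
  x ≈W y = ∀ n σ → x n σ ≈ y n σ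

  _−W_ : Coef → Coef → Coef
  (x −W y) n σ = x n σ + (- y n σ)

  sumOver : ∀ {A : Set} → List A → (A → Carrier) → Carrier
  sumOver xs f = foldr (λ a s → f a + s) 0# xs

  Φ : ∀ {n} → SetPartition n → Hom n
  Φ p q = if does (p ≟SP q) then 1# else 0#

  -- ∂ on degree n: Φ_π ↦ Σ_i Φ_{π with n+1 added to block i}
  -- (for n = 0 the partition ∅ has no blocks, so ∂(1) = 0)
  ∂Hom : ∀ {n} → Hom n → Hom (suc n)
  ∂Hom {n} h σ =
    sumOver (partitions n) λ { (k , π) → h (k , π) * sumOver (allFin k) (λ i → Φ (k , π ▷ i) σ) }

  ∂ : Coef → Coef
  ∂ x zero    σ = 0#
  ∂ x (suc n) σ = ∂Hom (x n) σ

  μHom : ∀ {n} → Hom n → Hom (suc n)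
  μHom {n} h σ = sumOver (partitions n) λ p → h p * Φ (p ·SP single) σ

  μ : Coef → Coef
  μ x zero    σ = 0#
  μ x (suc n) σ = μHom (x n) σ

  -- M-coordinates: since Φ_π = Σ_{π ≤ π'} M_π', the coefficient of M_σ in
  -- Σ_π h_π Φ_π is Σ_{π ≤ σ} h_π.
  toM : ∀ {n} → Hom n → Hom n
  toM {n} h σ = sumOver (partitions n) λ p → if does (p ≤P? σ) then h p else 0#

  -- φ(M_π) = Φ_π : the M-coordinates of x become the Φ-coordinates of φ(x)
  φ : Coef → Coef
  φ x n = toM (x n)

  IsInverseOfφ : (Coef → Coef) → Set (c ⊔ ℓ)
  IsInverseOfφ ψ = (∀ x → φ (ψ x) ≈W x) × (∀ x → ψ (φ x) ≈W x)

-- Every partition σ of {1,…,n+1} arises from exactly one partition of {1,…,n},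
-- namely restrict σ (delete n+1): either n+1 joins one of its blocks, a term of ∂,
-- or forms a new block, the term of μ. So in Φ-coordinates (∂ + μ) g takes the
-- value g (restrict σ) at σ. On the other side q ∪ {{n+1}} ≤ σ iff q ≤ restrict σ,
-- so φ (μ h) takes the value φ h (restrict σ) at σ. Hence φ ∘ μ = (∂ + μ) ∘ φ,
-- which is the theorem. φ is invertible by unitriangularity: a strictly finer
-- partition has strictly more blocks.

module Submission where

open import Defs
open import Level using (Level)
open import Algebra.Bundles using (CommutativeRing)
open import Data.Bool using (true; false; if_then_else_)
open import Data.Empty using (⊥-elim)
open import Data.Fin using (Fin; fromℕ; inject₁)
open import Data.Fin.Properties using (fromℕ≢inject₁; inject₁-injective; suc-injective)
open import Data.Fin.Relation.Unary.Top using (view; ‵fromℕ; ‵inject₁)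
open import Data.List using (List; []; _∷_; _++_; map; concatMap; allFin; tabulate)
open import Data.List.Properties using (map-tabulate)
open import Data.Nat using (ℕ; zero; suc; _≤_; _<_; z≤n; s≤s) renaming (_+_ to _+ℕ_)
open import Data.Nat.Properties
  using (≤-trans; <-irrefl; m≤n⇒m≤1+n; ≤∧≢⇒<; <⇒≱; +-suc; +-monoʳ-≤; m≤m+n)
open import Data.Product using (Σ; ∃; _,_; _×_; proj₁)
open import Data.Vec using (Vec; []; _∷_; _∷ʳ_; lookup) renaming (map to vmap)
open import Data.Vec.Properties using (lookup-map)
open import Function using (id; _∘_; _∘′_)
open import Function.Bundles using (_⇔_; mk⇔; module Equivalence)
open import Relation.Nullary using (¬_; Dec; yes; no; does)
open import Relation.Nullary.Decidable using (_×-dec_; ¬?; does-⇔)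
open import Relation.Binary.PropositionalEquality
  using (_≡_; _≢_; refl; sym; trans; cong; subst; module ≡-Reasoning)

private
  variable
    n k k′ : ℕ

lookup-∷ʳ-inject₁ : ∀ {A : Set} (xs : Vec A n) x (a : Fin n) → lookup (xs ∷ʳ x) (inject₁ a) ≡ lookup xs a
lookup-∷ʳ-inject₁ (y ∷ xs) x Fin.zero    = refl
lookup-∷ʳ-inject₁ (y ∷ xs) x (Fin.suc a) = lookup-∷ʳ-inject₁ xs x a

lookup-∷ʳ-fromℕ : ∀ {A : Set} (xs : Vec A n) x → lookup (xs ∷ʳ x) (fromℕ n) ≡ x
lookup-∷ʳ-fromℕ []       x = refl
lookup-∷ʳ-fromℕ (y ∷ xs) x = lookup-∷ʳ-fromℕ xs x

module _ (π : RGS n k) where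

  blockOf-▷-inject₁ : ∀ i a → blockOf (π ▷ i) (inject₁ a) ≡ blockOf π a
  blockOf-▷-inject₁ i = lookup-∷ʳ-inject₁ (labels π) i

  blockOf-▷-fromℕ : ∀ i → blockOf (π ▷ i) (fromℕ n) ≡ i
  blockOf-▷-fromℕ = lookup-∷ʳ-fromℕ (labels π)

  blockOf-▷new-inject₁ : ∀ a → blockOf (π ▷new) (inject₁ a) ≡ inject₁ (blockOf π a)
  blockOf-▷new-inject₁ a =
    trans (lookup-∷ʳ-inject₁ (vmap inject₁ (labels π)) (fromℕ k) a) (lookup-map a inject₁ (labels π))

  blockOf-▷new-fromℕ : blockOf (π ▷new) (fromℕ n) ≡ fromℕ k
  blockOf-▷new-fromℕ = lookup-∷ʳ-fromℕ (vmap inject₁ (labels π)) (fromℕ k)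

#blocks : SetPartition n → ℕ
#blocks = proj₁

#blocks≤ : RGS n k → k ≤ n
#blocks≤ []       = z≤n
#blocks≤ (π ▷ i)  = m≤n⇒m≤1+n (#blocks≤ π)
#blocks≤ (π ▷new) = s≤s (#blocks≤ π)

blockOf-surjective : (π : RGS n k) (i : Fin k) → ∃ λ a → blockOf π a ≡ i
blockOf-surjective (π ▷ j) i with blockOf-surjective π i
... | a , eq = inject₁ a , trans (blockOf-▷-inject₁ π j a) eq
blockOf-surjective {suc n} (π ▷new) i with view i
... | ‵fromℕ = fromℕ n , blockOf-▷new-fromℕ π
... | ‵inject₁ i′ with blockOf-surjective π i′
...   | a , eq = inject₁ a , trans (blockOf-▷new-inject₁ π a) (cong inject₁ eq)

SameBlock : SetPartition n → Fin n → Fin n → Set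
SameBlock (_ , π) a b = blockOf π a ≡ blockOf π b

≤P-refl : (p : SetPartition n) → p ≤P p
≤P-refl p a b = id

restrict : SetPartition (suc n) → SetPartition n
restrict (_ , π ▷ _) = _ , π
restrict (_ , π ▷new) = _ , π

sameBlock-restrict : ∀ (σ : SetPartition (suc n)) a b →
  SameBlock σ (inject₁ a) (inject₁ b) ⇔ SameBlock (restrict σ) a b
sameBlock-restrict (_ , π ▷ i) a b
  rewrite blockOf-▷-inject₁ π i a | blockOf-▷-inject₁ π i b = mk⇔ id id
sameBlock-restrict (_ , π ▷new) a b
  rewrite blockOf-▷new-inject₁ π a | blockOf-▷new-inject₁ π b = mk⇔ inject₁-injective (cong inject₁)

≤P-restrict : (p q : SetPartition (suc n)) → p ≤P q → restrict p ≤P restrict q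
≤P-restrict p q p≤q a b =
  Equivalence.to (sameBlock-restrict q a b)
  ∘′ p≤q (inject₁ a) (inject₁ b)
  ∘′ Equivalence.from (sameBlock-restrict p a b)

▷new-separates : (π : RGS n k) (a : Fin n) → ¬ SameBlock (suc k , π ▷new) (inject₁ a) (fromℕ n)
▷new-separates π a eq =
  fromℕ≢inject₁ (sym (trans (sym (blockOf-▷new-inject₁ π a)) (trans eq (blockOf-▷new-fromℕ π))))

▷≰P▷new : (π : RGS n k) (σ : RGS n k′) (i : Fin k) → ¬ ((k , π ▷ i) ≤P (suc k′ , σ ▷new))
▷≰P▷new {n} π σ i π▷i≤σ▷new with blockOf-surjective π i
... | a , eq = ▷new-separates σ a (π▷i≤σ▷new (inject₁ a) (fromℕ n)
                 (trans (blockOf-▷-inject₁ π i a) (trans eq (sym (blockOf-▷-fromℕ π i)))))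

·single-≤P : (p : SetPartition n) (σ : SetPartition (suc n)) → (p ·SP single) ≤P σ ⇔ p ≤P restrict σ
·single-≤P {n} (k , π) σ = mk⇔ (≤P-restrict (suc k , π ▷new) σ) extend
  where
  extend : (k , π) ≤P restrict σ → (suc k , π ▷new) ≤P σ
  extend π≤ a b with view a | view b
  ... | ‵fromℕ      | ‵fromℕ      = λ _ → refl
  ... | ‵fromℕ      | ‵inject₁ b′ = ⊥-elim ∘ ▷new-separates π b′ ∘ sym
  ... | ‵inject₁ a′ | ‵fromℕ      = ⊥-elim ∘ ▷new-separates π a′
  ... | ‵inject₁ a′ | ‵inject₁ b′ = λ eq →
    Equivalence.from (sameBlock-restrict σ a′ b′)
      (π≤ a′ b′ (Equivalence.to (sameBlock-restrict (suc k , π ▷new) a′ b′) eq))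

#blocks-antitone : (π : RGS n k) (σ : RGS n k′) → (k , π) ≤P (k′ , σ) → k′ ≤ k
#blocks-antitone []       []       _ = z≤n
#blocks-antitone (π ▷ i)  (σ ▷ j)  π≤σ =
  #blocks-antitone π σ (≤P-restrict (_ , π ▷ i) (_ , σ ▷ j) π≤σ)
#blocks-antitone (π ▷ i)  (σ ▷new) π≤σ = ⊥-elim (▷≰P▷new π σ i π≤σ)
#blocks-antitone (π ▷new) (σ ▷ j)  π≤σ =
  m≤n⇒m≤1+n (#blocks-antitone π σ (≤P-restrict (_ , π ▷new) (_ , σ ▷ j) π≤σ))
#blocks-antitone (π ▷new) (σ ▷new) π≤σ =
  s≤s (#blocks-antitone π σ (≤P-restrict (_ , π ▷new) (_ , σ ▷new) π≤σ))

≤P-equal-#blocks : (π σ : RGS n k) → (k , π) ≤P (k , σ) → π ≡ σ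
≤P-equal-#blocks []       []       _ = refl
≤P-equal-#blocks {suc n} (π ▷ i) (σ ▷ j) π≤σ
  with refl ← ≤P-equal-#blocks π σ (≤P-restrict (_ , π ▷ i) (_ , σ ▷ j) π≤σ)
  with a , eq ← blockOf-surjective π i =
  cong (π ▷_) (begin
    i                              ≡⟨ sym eq ⟩
    blockOf π a                    ≡⟨ sym (blockOf-▷-inject₁ π j a) ⟩
    blockOf (π ▷ j) (inject₁ a)    ≡⟨ π≤σ (inject₁ a) (fromℕ n) same ⟩
    blockOf (π ▷ j) (fromℕ n)      ≡⟨ blockOf-▷-fromℕ π j ⟩
    j                              ∎)
  where
  open ≡-Reasoning
  same : blockOf (π ▷ i) (inject₁ a) ≡ blockOf (π ▷ i) (fromℕ n)
  same = trans (blockOf-▷-inject₁ π i a) (trans eq (sym (blockOf-▷-fromℕ π i)))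
≤P-equal-#blocks (π ▷ i)  (σ ▷new) π≤σ = ⊥-elim (▷≰P▷new π σ i π≤σ)
≤P-equal-#blocks (π ▷new) (σ ▷ j)  π≤σ =
  ⊥-elim (<-irrefl refl (#blocks-antitone π σ (≤P-restrict (_ , π ▷new) (_ , σ ▷ j) π≤σ)))
≤P-equal-#blocks (π ▷new) (σ ▷new) π≤σ =
  cong _▷new (≤P-equal-#blocks π σ (≤P-restrict (_ , π ▷new) (_ , σ ▷new) π≤σ))

_<P_ : SetPartition n → SetPartition n → Set
p <P q = p ≤P q × p ≢ q

_<P?_ : (p q : SetPartition n) → Dec (p <P q)
p <P? q = (p ≤P? q) ×-dec ¬? (p ≟SP q)

<P⇒#blocks> : {p q : SetPartition n} → p <P q → #blocks q < #blocks p
<P⇒#blocks> {p = k , π} {k′ , σ} (π≤σ , π≢σ) =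
  ≤∧≢⇒< (#blocks-antitone π σ π≤σ) λ { refl → π≢σ (cong (k ,_) (≤P-equal-#blocks π σ π≤σ)) }

-- A strict chain p₁ <P ⋯ <P q has at most n − #blocks q steps, so this many
-- rounds of the iteration inverting φ below already fix its value at q.
EnoughRounds : ℕ → SetPartition n → Set
EnoughRounds {n} f q = n < f +ℕ #blocks q

¬EnoughRounds-zero : (q : SetPartition n) → ¬ EnoughRounds 0 q
¬EnoughRounds-zero (_ , π) n<k = <⇒≱ n<k (#blocks≤ π)

EnoughRounds-<P : ∀ {f} {p q : SetPartition n} → p <P q → EnoughRounds (suc f) q → EnoughRounds f p
EnoughRounds-<P {f = f} {p} {q} p<q rounds =
  ≤-trans rounds (subst (_≤ f +ℕ #blocks p) (+-suc f (#blocks q)) (+-monoʳ-≤ f (<P⇒#blocks> p<q)))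

EnoughRounds-suc-n : (q : SetPartition n) → EnoughRounds (suc n) q
EnoughRounds-suc-n {n} q = m≤m+n (suc n) (#blocks q)

module WSymProperties {c ℓ : Level} (R : CommutativeRing c ℓ) where

  open CommutativeRing R renaming (refl to ≈-refl; sym to ≈-sym; trans to ≈-trans)
  open WSymOver R
  open import Algebra.Properties.Group +-group using (//-rightDividesˡ; //-rightDividesʳ)
  open import Algebra.Properties.CommutativeSemigroup +-commutativeSemigroup using (interchange)
  open import Relation.Binary.Reasoning.Setoid setoid

  if-yes : ∀ {A : Set} (a? : Dec A) {x} → A → (if does a? then x else 0#) ≈ x
  if-yes (yes _) _ = ≈-refl
  if-yes (no ¬a) a = ⊥-elim (¬a a)

  if-no : ∀ {A : Set} (a? : Dec A) {x} → ¬ A → (if does a? then x else 0#) ≈ 0#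
  if-no (yes a) ¬a = ⊥-elim (¬a a)
  if-no (no _)  _  = ≈-refl

  if-zero : ∀ b {x} → x ≈ 0# → (if b then x else 0#) ≈ 0#
  if-zero true  x≈0 = x≈0
  if-zero false _   = ≈-refl

  if-dec-cong : ∀ {A : Set} (a? : Dec A) {x y} → (A → x ≈ y) →
                (if does a? then x else 0#) ≈ (if does a? then y else 0#)
  if-dec-cong (yes a) x≈y = x≈y a
  if-dec-cong (no _)  _   = ≈-refl

  if-split : ∀ {A B : Set} (a? : Dec A) (b? : Dec B) {x} → (B → A) →
             (if does a? then x else 0#)
               ≈ (if does b? then x else 0#) + (if does (a? ×-dec ¬? b?) then x else 0#)
  if-split (yes _) (yes _) _   = ≈-sym (+-identityʳ _)
  if-split (yes _) (no _)  _   = ≈-sym (+-identityˡ _)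
  if-split (no ¬a) (yes b) B⇒A = ⊥-elim (¬a (B⇒A b))
  if-split (no _)  (no _)  _   = ≈-sym (+-identityˡ 0#)

  sum-cong : ∀ {A : Set} (xs : List A) {f g : A → Carrier} →
             (∀ a → f a ≈ g a) → sumOver xs f ≈ sumOver xs g
  sum-cong []       _   = ≈-refl
  sum-cong (x ∷ xs) f≈g = +-cong (f≈g x) (sum-cong xs f≈g)

  sum-zero : ∀ {A : Set} (xs : List A) {f : A → Carrier} → (∀ a → f a ≈ 0#) → sumOver xs f ≈ 0#
  sum-zero []       _   = ≈-refl
  sum-zero (x ∷ xs) f≈0 = ≈-trans (+-cong (f≈0 x) (sum-zero xs f≈0)) (+-identityˡ 0#)

  sum-distrib-+ : ∀ {A : Set} (xs : List A) (f g : A → Carrier) →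
                  sumOver xs (λ a → f a + g a) ≈ sumOver xs f + sumOver xs g
  sum-distrib-+ []       _ _ = ≈-sym (+-identityˡ 0#)
  sum-distrib-+ (x ∷ xs) f g = ≈-trans (+-congˡ (sum-distrib-+ xs f g)) (interchange (f x) (g x) _ _)

  sum-++ : ∀ {A : Set} (xs ys : List A) (f : A → Carrier) →
           sumOver (xs ++ ys) f ≈ sumOver xs f + sumOver ys f
  sum-++ []       ys f = ≈-sym (+-identityˡ _)
  sum-++ (x ∷ xs) ys f = ≈-trans (+-congˡ (sum-++ xs ys f)) (≈-sym (+-assoc _ _ _))

  sum-map : ∀ {A B : Set} (g : A → B) (xs : List A) (f : B → Carrier) →
            sumOver (map g xs) f ≈ sumOver xs (f ∘ g)
  sum-map g []       f = ≈-refl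
  sum-map g (x ∷ xs) f = +-congˡ (sum-map g xs f)

  sum-concatMap : ∀ {A B : Set} (g : A → List B) (xs : List A) (f : B → Carrier) →
                  sumOver (concatMap g xs) f ≈ sumOver xs (λ a → sumOver (g a) f)
  sum-concatMap g []       f = ≈-refl
  sum-concatMap g (x ∷ xs) f = ≈-trans (sum-++ (g x) (concatMap g xs) f) (+-congˡ (sum-concatMap g xs f))

  sum-allFin-suc : ∀ k (f : Fin (suc k) → Carrier) →
                   sumOver (allFin (suc k)) f ≈ f Fin.zero + sumOver (allFin k) (f ∘ Fin.suc)
  sum-allFin-suc k f = +-congˡ (begin
    sumOver (tabulate Fin.suc) f        ≡⟨ cong (λ xs → sumOver xs f) (sym (map-tabulate id Fin.suc)) ⟩
    sumOver (map Fin.suc (allFin k)) f  ≈⟨ sum-map Fin.suc (allFin k) f ⟩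
    sumOver (allFin k) (f ∘ Fin.suc)    ∎)

  sum-allFin-single : ∀ {k} (j : Fin k) (f : Fin k → Carrier) →
                      (∀ i → i ≢ j → f i ≈ 0#) → sumOver (allFin k) f ≈ f j
  sum-allFin-single {suc k} Fin.zero f off = begin
    sumOver (allFin (suc k)) f                    ≈⟨ sum-allFin-suc k f ⟩
    f Fin.zero + sumOver (allFin k) (f ∘ Fin.suc) ≈⟨ +-congˡ (sum-zero (allFin k) λ i → off (Fin.suc i) λ ()) ⟩
    f Fin.zero + 0#                               ≈⟨ +-identityʳ _ ⟩
    f Fin.zero                                    ∎
  sum-allFin-single {suc k} (Fin.suc j) f off = begin
    sumOver (allFin (suc k)) f                    ≈⟨ sum-allFin-suc k f ⟩
    f Fin.zero + sumOver (allFin k) (f ∘ Fin.suc)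
      ≈⟨ +-cong (off Fin.zero λ ())
                (sum-allFin-single j (f ∘ Fin.suc) λ i i≢j → off (Fin.suc i) (i≢j ∘ suc-injective)) ⟩
    0# + f (Fin.suc j)                            ≈⟨ +-identityˡ _ ⟩
    f (Fin.suc j)                                 ∎

  sumExtensions : (SetPartition (suc n) → Carrier) → SetPartition n → Carrier
  sumExtensions f (k , π) = sumOver (allFin k) (λ i → f (k , π ▷ i)) + f (suc k , π ▷new)

  sum-partitions-suc : (f : SetPartition (suc n) → Carrier) →
                       sumOver (partitions (suc n)) f ≈ sumOver (partitions n) (sumExtensions f)
  sum-partitions-suc {n} f = ≈-trans (sum-concatMap _ (partitions n) f) (sum-cong (partitions n) λ { (k , π) →
    ≈-trans (sum-++ (map (λ i → k , π ▷ i) (allFin k)) _ f)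
            (+-cong (sum-map _ (allFin k) f) (+-identityʳ _)) })

  sumExtensions-restrict : (r : SetPartition (suc n)) (f : SetPartition (suc n) → Carrier) →
                           (∀ p → p ≢ r → f p ≈ 0#) → sumExtensions f (restrict r) ≈ f r
  sumExtensions-restrict (k , ρ ▷ j) f off = ≈-trans
    (+-cong (sum-allFin-single j _ λ i i≢j → off _ λ { refl → i≢j refl }) (off _ λ ()))
    (+-identityʳ _)
  sumExtensions-restrict (_ , ρ ▷new) f off = ≈-trans
    (+-congʳ (sum-zero (allFin _) λ i → off (_ , ρ ▷ i) λ ()))
    (+-identityˡ _)

  sum-partitions-single : ∀ n (r : SetPartition n) (f : SetPartition n → Carrier) →
                          (∀ p → p ≢ r → f p ≈ 0#) → sumOver (partitions n) f ≈ f r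
  sum-partitions-single zero    (_ , []) f _   = +-identityʳ _
  sum-partitions-single (suc n) r        f off = begin
    sumOver (partitions (suc n)) f             ≈⟨ sum-partitions-suc f ⟩
    sumOver (partitions n) (sumExtensions f)   ≈⟨ sum-partitions-single n (restrict r) _ extensions-off ⟩
    sumExtensions f (restrict r)               ≈⟨ sumExtensions-restrict r f off ⟩
    f r                                        ∎
    where
    extensions-off : ∀ p → p ≢ restrict r → sumExtensions f p ≈ 0#
    extensions-off (k , π) π≢r = ≈-trans
      (+-cong (sum-zero (allFin k) λ i → off _ (π≢r ∘ cong restrict)) (off _ (π≢r ∘ cong restrict)))
      (+-identityˡ 0#)

  sumBelow : Hom n → Hom n
  sumBelow {n} h q = sumOver (partitions n) λ p → if does (p <P? q) then h p else 0#

  toM≈self+sumBelow : (h : Hom n) (q : SetPartition n) → toM h q ≈ h q + sumBelow h q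
  toM≈self+sumBelow {n} h q = begin
    toM h q
      ≈⟨ sum-cong (partitions n) (λ p → if-split (p ≤P? q) (p ≟SP q) λ { refl → ≤P-refl p }) ⟩
    sumOver (partitions n) (λ p → (if does (p ≟SP q) then h p else 0#) + (if does (p <P? q) then h p else 0#))
      ≈⟨ sum-distrib-+ (partitions n) _ _ ⟩
    sumOver (partitions n) (λ p → if does (p ≟SP q) then h p else 0#) + sumBelow h q
      ≈⟨ +-congʳ (sum-partitions-single n q _ λ p p≢q → if-no (p ≟SP q) p≢q) ⟩
    (if does (q ≟SP q) then h q else 0#) + sumBelow h q
      ≈⟨ +-congʳ (if-yes (q ≟SP q) refl) ⟩
    h q + sumBelow h q ∎

  -- Since toM h q = h q + sumBelow h q, the inverse ψ solves ψ h q = h q − sumBelow (ψ h) q;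
  -- this is the f-th iterate of that equation, started at 0.
  invIterate : ℕ → Hom n → Hom n
  invIterate zero    h q = 0#
  invIterate (suc f) h q = h q + - sumBelow (invIterate f h) q

  invIterate-stable : ∀ {f} (h : Hom n) (q : SetPartition n) → EnoughRounds f q →
                      invIterate f h q ≈ invIterate (suc f) h q
  invIterate-stable {f = zero}  h q rounds = ⊥-elim (¬EnoughRounds-zero q rounds)
  invIterate-stable {n} {suc f} h q rounds = +-congˡ (-‿cong (sum-cong (partitions n) λ p →
    if-dec-cong (p <P? q) λ p<q → invIterate-stable h p (EnoughRounds-<P p<q rounds)))

  ψHom : Hom n → Hom n
  ψHom {n} = invIterate (suc n)

  toM-ψHom : (h : Hom n) (q : SetPartition n) → toM (ψHom h) q ≈ h q
  toM-ψHom {n} h q = begin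
    toM (ψHom h) q
      ≈⟨ toM≈self+sumBelow (ψHom h) q ⟩
    (h q + - sumBelow (invIterate n h) q) + sumBelow (ψHom h) q
      ≈⟨ +-congˡ (sum-cong (partitions n) λ p → if-dec-cong (p <P? q) λ p<q →
           ≈-sym (invIterate-stable h p (EnoughRounds-<P p<q (EnoughRounds-suc-n q)))) ⟩
    (h q + - sumBelow (invIterate n h) q) + sumBelow (invIterate n h) q
      ≈⟨ //-rightDividesˡ _ _ ⟩
    h q ∎

  invIterate-toM : ∀ {f} (h : Hom n) (q : SetPartition n) → EnoughRounds f q →
                   invIterate f (toM h) q ≈ h q
  invIterate-toM {f = zero}  h q rounds = ⊥-elim (¬EnoughRounds-zero q rounds)
  invIterate-toM {n} {suc f} h q rounds = begin
    toM h q + - sumBelow (invIterate f (toM h)) q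
      ≈⟨ +-cong (toM≈self+sumBelow h q) (-‿cong (sum-cong (partitions n) λ p →
           if-dec-cong (p <P? q) λ p<q → invIterate-toM h p (EnoughRounds-<P p<q rounds))) ⟩
    (h q + sumBelow h q) + - sumBelow h q
      ≈⟨ //-rightDividesʳ _ _ ⟩
    h q ∎

  ψ : Coef → Coef
  ψ x n = ψHom (x n)

  ψ-inverse : IsInverseOfφ ψ
  ψ-inverse = (λ x n → toM-ψHom (x n)) ,
              (λ x n q → invIterate-toM (x n) q (EnoughRounds-suc-n q))

  μHom-·single : (h : Hom n) (p : SetPartition n) → μHom h (p ·SP single) ≈ h p
  μHom-·single {n} h (k , π) = begin
    μHom h (suc k , π ▷new)
      ≈⟨ sum-partitions-single n (k , π) _ (λ { (k′ , ρ) ρ≢π → ≈-trans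
           (*-congˡ (if-no ((suc k′ , ρ ▷new) ≟SP (suc k , π ▷new)) λ { refl → ρ≢π refl })) (zeroʳ _) }) ⟩
    h (k , π) * Φ (suc k , π ▷new) (suc k , π ▷new)
      ≈⟨ *-congˡ (if-yes ((suc k , π ▷new) ≟SP (suc k , π ▷new)) refl) ⟩
    h (k , π) * 1#                                    ≈⟨ *-identityʳ _ ⟩
    h (k , π)                                         ∎

  μHom-▷ : (h : Hom n) (π : RGS n k) (i : Fin k) → μHom h (k , π ▷ i) ≈ 0#
  μHom-▷ {n} {k} h π i = sum-zero (partitions n) λ { (k′ , ρ) →
    ≈-trans (*-congˡ (if-no ((suc k′ , ρ ▷new) ≟SP (k , π ▷ i)) {1#} λ ())) (zeroʳ _) }

  ∂Hom-▷ : (g : Hom n) (π : RGS n k) (i : Fin k) → ∂Hom g (k , π ▷ i) ≈ g (k , π)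
  ∂Hom-▷ {n} {k} g π i = begin
    ∂Hom g (k , π ▷ i)
      ≈⟨ sum-partitions-single n (k , π) _ (λ { (k′ , ρ) ρ≢π → ≈-trans
           (*-congˡ (sum-zero (allFin k′) λ j → if-no ((k′ , ρ ▷ j) ≟SP (k , π ▷ i)) λ { refl → ρ≢π refl }))
           (zeroʳ _) }) ⟩
    g (k , π) * sumOver (allFin k) (λ j → Φ (k , π ▷ j) (k , π ▷ i))
      ≈⟨ *-congˡ (sum-allFin-single i _ λ j j≢i →
           if-no ((k , π ▷ j) ≟SP (k , π ▷ i)) λ { refl → j≢i refl }) ⟩
    g (k , π) * Φ (k , π ▷ i) (k , π ▷ i)   ≈⟨ *-congˡ (if-yes ((k , π ▷ i) ≟SP (k , π ▷ i)) refl) ⟩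
    g (k , π) * 1#                          ≈⟨ *-identityʳ _ ⟩
    g (k , π)                               ∎

  ∂Hom-▷new : (g : Hom n) (π : RGS n k) → ∂Hom g (suc k , π ▷new) ≈ 0#
  ∂Hom-▷new {n} {k} g π = sum-zero (partitions n) λ { (k′ , ρ) →
    ≈-trans (*-congˡ (sum-zero (allFin k′) λ j → if-no ((k′ , ρ ▷ j) ≟SP (suc k , π ▷new)) {1#} λ ()))
            (zeroʳ _) }

  ∂Hom+μHom : (g : Hom n) (σ : SetPartition (suc n)) → ∂Hom g σ + μHom g σ ≈ g (restrict σ)
  ∂Hom+μHom g (_ , π ▷ i) = ≈-trans (+-cong (∂Hom-▷ g π i) (μHom-▷ g π i)) (+-identityʳ _)
  ∂Hom+μHom g (_ , π ▷new) =
    ≈-trans (+-cong (∂Hom-▷new g π) (μHom-·single g (_ , π))) (+-identityˡ _)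

  toM-μHom : (h : Hom n) (σ : SetPartition (suc n)) → toM (μHom h) σ ≈ toM h (restrict σ)
  toM-μHom {n} h σ = ≈-trans (sum-partitions-suc {n} _) (sum-cong (partitions n) extensions)
    where
    extensions : ∀ p → sumExtensions (λ p′ → if does (p′ ≤P? σ) then μHom h p′ else 0#) p
                       ≈ (if does (p ≤P? restrict σ) then h p else 0#)
    extensions p@(k , π) = begin
      sumOver (allFin k) (λ i → if does ((k , π ▷ i) ≤P? σ) then μHom h (k , π ▷ i) else 0#)
        + (if does ((p ·SP single) ≤P? σ) then μHom h (p ·SP single) else 0#)
          ≈⟨ +-cong (sum-zero (allFin k) λ i → if-zero _ (μHom-▷ h π i))
                    (if-dec-cong ((p ·SP single) ≤P? σ) λ _ → μHom-·single h p) ⟩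
      0# + (if does ((p ·SP single) ≤P? σ) then h p else 0#)
          ≈⟨ +-identityˡ _ ⟩
      (if does ((p ·SP single) ≤P? σ) then h p else 0#)
          ≡⟨ cong (λ b → if b then h p else 0#)
                  (does-⇔ (·single-≤P p σ) ((p ·SP single) ≤P? σ) (p ≤P? restrict σ)) ⟩
      (if does (p ≤P? restrict σ) then h p else 0#) ∎

  ∂≈φμψ−μ : ∀ ψ′ → IsInverseOfφ ψ′ → ∀ x → FinSupp x → ∂ x ≈W (φ (μ (ψ′ x)) −W μ x)
  ∂≈φμψ−μ ψ′ _ x _ zero σ =
    ≈-sym (≈-trans (+-congʳ (sum-zero (partitions 0) λ p → if-zero (does (p ≤P? σ)) ≈-refl)) (-‿inverseʳ 0#))
  ∂≈φμψ−μ ψ′ (φψ′≈id , _) x _ (suc m) σ = begin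
    ∂Hom (x m) σ                                         ≈⟨ //-rightDividesʳ _ _ ⟨
    (∂Hom (x m) σ + μHom (x m) σ) + - μHom (x m) σ       ≈⟨ +-congʳ (∂Hom+μHom (x m) σ) ⟩
    x m (restrict σ) + - μHom (x m) σ                    ≈⟨ +-congʳ (φψ′≈id x m (restrict σ)) ⟨
    toM (ψ′ x m) (restrict σ) + - μHom (x m) σ           ≈⟨ +-congʳ (toM-μHom (ψ′ x m) σ) ⟨
    toM (μHom (ψ′ x m)) σ + - μHom (x m) σ               ∎

open WSymProperties

mainTheorem7 : ∀ {c ℓ : Level} (R : CommutativeRing c ℓ) → let open WSymOver R in
    Σ (Coef → Coef) IsInverseOfφ
    × (∀ ψ → IsInverseOfφ ψ → ∀ x → FinSupp x → ∂ x ≈W (φ (μ (ψ x)) −W μ x))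
mainTheorem7 R = (ψ R , ψ-inverse R) , ∂≈φμψ−μ R
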